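{- The pair $\mathcal I_{\mathrm{symm}}=(\Sigma_{\mathrm{symm}},\vdash)$ is an effective intruder model, i.e. $\vdash$ is decidable and satisfies the axioms Id, Mon, Cut, Constr, Alpha and Relevancy.
   Context: Fix a countably infinite set $\mathcal N$ of names. For a signature $\Sigma$ (finite set of constructor symbols with arities), messages are the terms built from names by applying constructors; finite sets of messages are denoted $\Gamma$, with $\Gamma,\Gamma'=\Gamma\cup\Gamma'$ and $\Gamma,M=\Gamma\cup\{M\}$; $\mathrm{names}(M)$ is the set of names in $M$. A renaming of $X\subseteq\mathcal N$ is an injective map defined on $X$ with values in $\mathcal N$, applied homomorphically. An intruder model is a pair $(\Sigma,\vdash)$ with $\vdash$ a relation between finite sets of messages and messages satisfying, for all $M,N,\Gamma,\Gamma'$ and names $a$: (Id) $\{M\}\vdash M$; (Mon) $\Gamma\subseteq\Gamma'$, $\Gamma\vdash M$ imply $\Gamma'\vdash M$; (Cut) $\Gamma\vdash M$ and $\Gamma,M\vdash N$ imply $\Gamma\vdash N$; (Constr) $\{M_1,\dots,M_n\}\vdash f(M_1,\dots,M_n)$ for every constructor $f$ of arity $n$; (Alpha) $\Gamma\theta\vdash M\theta$ iff $\Gamma\vdash M$ for every renaming $\theta$ of $\mathrm{names}(\Gamma)$; (Relevancy) $\Gamma,a\vdash M$ and $a\notin\mathrm{names}(\Gamma)\cup\mathrm{names}(M)$ imply $\Gamma\vdash M$. It is effective if $\vdash$ is decidable. The signature $\Sigma_{\mathrm{symm}}$ consists of the binary constructors $(M,N)$ (pairing), $\{M\}_N$ (symmetric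 encryption), $\{\!|M|\!\}_N$ (asymmetric encryption) and the unary constructor $\mathrm{pub}(K)$ (public key of private key $K$). The relation $\vdash$ of $\mathcal I_{\mathrm{symm}}$ is the smallest relation closed under the rules: (Id) if $M\in\Gamma$ then $\Gamma\vdash M$; (Pub) from $\Gamma\vdash K$ infer $\Gamma\vdash\mathrm{pub}(K)$; (P$_L$) from $\Gamma,(M,N),M,N\vdash M'$ infer $\Gamma,(M,N)\vdash M'$; (P$_R$) from $\Gamma\vdash M$ and $\Gamma\vdash N$ infer $\Gamma\vdash(M,N)$; (S$_L$) from $\Gamma,\{M\}_K\vdash K$ and $\Gamma,\{M\}_K,M,K\vdash N$ infer $\Gamma,\{M\}_K\vdash N$; (S$_R$) from $\Gamma\vdash M$ and $\Gamma\vdash K$ infer $\Gamma\vdash\{M\}_K$; (A$_L$) from $\Gamma,\{\!|M|\!\}_{\mathrm{pub}(K)}\vdash K$ and $\Gamma,\{\!|M|\!\}_{\mathrm{pub}(K)},M,K\vdash N$ infer $\Gamma,\{\!|M|\!\}_{\mathrm{pub}(K)}\vdash N$; (A$_R$) from $\Gamma\vdash M$ and $\Gamma\vdash N$ infer $\Gamma\vdash\{\!|M|\!\}_N$. -}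

module Defs where

open import Data.Nat using (ℕ)
open import Data.List using (List; []; _∷_; _++_; concatMap; map)
open import Data.List.Membership.Propositional using (_∈_; _∉_)
open import Data.List.Relation.Binary.Subset.Propositional using (_⊆_)
open import Data.Product using (_×_)
open import Relation.Binary.PropositionalEquality using (_≡_)
open import Relation.Nullary using (Dec)

Name : Set
Name = ℕ

data Msg : Set where
  nm   : Name → Msg
  pair : Msg → Msg → Msg
  senc : Msg → Msg → Msg
  aenc : Msg → Msg → Msg
  pub  : Msg → Msg

-- Finite sets of messages are represented by lists (only membership matters).
MsgSet : Set
MsgSet = List Msg

names : Msg → List Name
names (nm a)     = a ∷ []
names (pair M N) = names M ++ names N
names (senc M N) = names M ++ names N
names (aenc M N) = names M ++ names N
names (pub K)    = names K

namesSet : MsgSet → List Name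
namesSet Γ = concatMap names Γ

rename : (Name → Name) → Msg → Msg
rename θ (nm a)     = nm (θ a)
rename θ (pair M N) = pair (rename θ M) (rename θ N)
rename θ (senc M N) = senc (rename θ M) (rename θ N)
rename θ (aenc M N) = aenc (rename θ M) (rename θ N)
rename θ (pub K)    = pub (rename θ K)

renameSet : (Name → Name) → MsgSet → MsgSet
renameSet θ Γ = map (rename θ) Γ

InjectiveOn : (Name → Name) → List Name → Set
InjectiveOn θ X = ∀ {a b} → a ∈ X → b ∈ X → θ a ≡ θ b → a ≡ b

-- The deduction relation of I_symm: smallest relation closed under the rules.
-- "Γ , X" with X ∈ Γ is expressed by a membership premise; adding M, N is consing.
infix 4 _⊢_
data _⊢_ : MsgSet → Msg → Set where
  ax   : ∀ {Γ M} → M ∈ Γ → Γ ⊢ M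
  pubR : ∀ {Γ K} → Γ ⊢ K → Γ ⊢ pub K
  PL   : ∀ {Γ M N M'} → pair M N ∈ Γ → (M ∷ N ∷ Γ) ⊢ M' → Γ ⊢ M'
  PR   : ∀ {Γ M N} → Γ ⊢ M → Γ ⊢ N → Γ ⊢ pair M N
  SL   : ∀ {Γ M K N} → senc M K ∈ Γ → Γ ⊢ K → (M ∷ K ∷ Γ) ⊢ N → Γ ⊢ N
  SR   : ∀ {Γ M K} → Γ ⊢ M → Γ ⊢ K → Γ ⊢ senc M K
  AL   : ∀ {Γ M K N} → aenc M (pub K) ∈ Γ → Γ ⊢ K → (M ∷ K ∷ Γ) ⊢ N → Γ ⊢ N
  AR   : ∀ {Γ M N} → Γ ⊢ M → Γ ⊢ N → Γ ⊢ aenc M N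

record IsEffectiveIntruderModel (_⊩_ : MsgSet → Msg → Set) : Set where
  field
    Id       : ∀ M → (M ∷ []) ⊩ M
    Mon      : ∀ {Γ Γ' M} → Γ ⊆ Γ' → Γ ⊩ M → Γ' ⊩ M
    Cut      : ∀ {Γ M N} → Γ ⊩ M → (M ∷ Γ) ⊩ N → Γ ⊩ N
    ConstrPair : ∀ M N → (M ∷ N ∷ []) ⊩ pair M N
    ConstrSenc : ∀ M N → (M ∷ N ∷ []) ⊩ senc M N
    ConstrAenc : ∀ M N → (M ∷ N ∷ []) ⊩ aenc M N
    ConstrPub  : ∀ K → (K ∷ []) ⊩ pub K
    Alpha    : ∀ Γ M (θ : Name → Name) →
               InjectiveOn θ (namesSet Γ ++ names M) →
               ((renameSet θ Γ ⊩ rename θ M → Γ ⊩ M) × (Γ ⊩ M → renameSet θ Γ ⊩ rename θ M))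
    Relevancy : ∀ Γ M a → (nm a ∷ Γ) ⊩ M → a ∉ namesSet Γ → a ∉ names M → Γ ⊩ M
    Decidable : ∀ Γ M → Dec (Γ ⊩ M)

-- Cut is admissible by induction on the cut message, then on the derivation: a left
-- rule that opens the cut message meets, by inversion, derivations of its two
-- components, which are cut in turn.  Renaming acts on derivations rule by rule, and
-- injectivity on the names involved provides a left inverse.  A fresh name is never a
-- pair or a ciphertext, so no left rule uses it and it can be dropped.
-- For decidability, repeatedly replace a hypothesis that a left rule can open (a pair,
-- or a ciphertext whose key is synthesizable) by its two components: this preserves
-- the consequences and lowers the total size.  Once no hypothesis can be opened, left
-- rules are useless, so derivability is synthesis by right rules, decided by recursion
-- on the goal.

module Submission where

open import Defs
open import Data.Nat using (ℕ; suc; _+_; _<_; s≤s)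
open import Data.Nat.Properties using (n<1+n; n≤1+n; +-assoc; +-monoˡ-<; +-monoʳ-≤; module ≤-Reasoning)
import Data.Nat.Properties as ℕ
open import Data.Nat.Induction using (<-wellFounded)
open import Data.Nat.ListAction using (sum)
open import Data.Nat.ListAction.Properties using (sum-↭)
open import Data.List using (List; []; _∷_; _++_; map)
open import Data.List.Membership.Propositional using (_∈_; _∉_; find; lose)
open import Data.List.Membership.Propositional.Properties using (∈-++⁺ˡ; ∈-++⁺ʳ; ∈-++⁻; ∈-map⁺; ∈-∃++)
import Data.List.Membership.DecPropositional
open import Data.List.Relation.Unary.Any using (Any; here; there; any?)
open import Data.List.Relation.Unary.All using (All; _∷_; lookup; tabulate)
open import Data.List.Relation.Binary.Subset.Propositional using (_⊆_)
open import Data.List.Relation.Binary.Subset.Propositional.Properties using (⊆-refl; ⊆-trans; ⊆-reflexive-↭; xs⊆x∷xs; xs⊆xs++ys; xs⊆ys++xs; ∷⁺ʳ)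
open import Data.List.Relation.Binary.Permutation.Propositional using (_↭_; ↭-sym)
open import Data.List.Relation.Binary.Permutation.Propositional.Properties using (shift; map⁺)
open import Data.Product using (Σ; ∃; _×_; _,_; uncurry)
open import Data.Sum using (inj₁; inj₂)
open import Data.Empty using (⊥-elim)
open import Function using (_∘_; id)
open import Induction.WellFounded using (Acc; acc)
open import Relation.Binary.Definitions using (DecidableEquality)
open import Relation.Binary.PropositionalEquality using (_≡_; refl; cong; cong₂; subst₂)
open import Relation.Nullary using (Dec; yes; no; ¬_)
open import Relation.Nullary.Decidable using (map′; _×-dec_)

⊆-push₂ : ∀ {M A B : Msg} {Δ Γ} → Δ ⊆ M ∷ Γ → A ∷ B ∷ Δ ⊆ M ∷ A ∷ B ∷ Γ
⊆-push₂ s (here refl)         = there (here refl)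
⊆-push₂ s (there (here refl)) = there (there (here refl))
⊆-push₂ s (there (there p)) with s p
... | here refl = here refl
... | there q   = there (there (there q))

⊢-mono : ∀ {Γ Γ' M} → Γ ⊆ Γ' → Γ ⊢ M → Γ' ⊢ M
⊢-mono s (ax p)      = ax (s p)
⊢-mono s (pubR d)    = pubR (⊢-mono s d)
⊢-mono s (PL p d)    = PL (s p) (⊢-mono (∷⁺ʳ _ (∷⁺ʳ _ s)) d)
⊢-mono s (PR d e)    = PR (⊢-mono s d) (⊢-mono s e)
⊢-mono s (SL p k d)  = SL (s p) (⊢-mono s k) (⊢-mono (∷⁺ʳ _ (∷⁺ʳ _ s)) d)
⊢-mono s (SR d e)    = SR (⊢-mono s d) (⊢-mono s e)
⊢-mono s (AL p k d)  = AL (s p) (⊢-mono s k) (⊢-mono (∷⁺ʳ _ (∷⁺ʳ _ s)) d)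
⊢-mono s (AR d e)    = AR (⊢-mono s d) (⊢-mono s e)

⊢-weaken : ∀ {Γ A M} → Γ ⊢ M → A ∷ Γ ⊢ M
⊢-weaken = ⊢-mono (xs⊆x∷xs _ _)

⊢-weaken₂ : ∀ {Γ A B M} → Γ ⊢ M → A ∷ B ∷ Γ ⊢ M
⊢-weaken₂ = ⊢-weaken ∘ ⊢-weaken

⊢-pair⁻ : ∀ {Γ A B} → Γ ⊢ pair A B → Γ ⊢ A × Γ ⊢ B
⊢-pair⁻ (ax p)     = PL p (ax (here refl)) , PL p (ax (there (here refl)))
⊢-pair⁻ (PR a b)   = a , b
⊢-pair⁻ (PL p d)   = let a , b = ⊢-pair⁻ d in PL p a , PL p b
⊢-pair⁻ (SL p k d) = let a , b = ⊢-pair⁻ d in SL p k a , SL p k b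
⊢-pair⁻ (AL p k d) = let a , b = ⊢-pair⁻ d in AL p k a , AL p k b

⊢-senc⁻ : ∀ {Γ A K} → Γ ⊢ senc A K → Γ ⊢ K → Γ ⊢ A
⊢-senc⁻ (ax p)      k = SL p k (ax (here refl))
⊢-senc⁻ (SR a _)    k = a
⊢-senc⁻ (PL p d)    k = PL p (⊢-senc⁻ d (⊢-weaken₂ k))
⊢-senc⁻ (SL p k' d) k = SL p k' (⊢-senc⁻ d (⊢-weaken₂ k))
⊢-senc⁻ (AL p k' d) k = AL p k' (⊢-senc⁻ d (⊢-weaken₂ k))

⊢-aenc⁻ : ∀ {Γ A K} → Γ ⊢ aenc A (pub K) → Γ ⊢ K → Γ ⊢ A
⊢-aenc⁻ (ax p)      k = AL p k (ax (here refl))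
⊢-aenc⁻ (AR a _)    k = a
⊢-aenc⁻ (PL p d)    k = PL p (⊢-aenc⁻ d (⊢-weaken₂ k))
⊢-aenc⁻ (SL p k' d) k = SL p k' (⊢-aenc⁻ d (⊢-weaken₂ k))
⊢-aenc⁻ (AL p k' d) k = AL p k' (⊢-aenc⁻ d (⊢-weaken₂ k))

mutual
  ⊢-cut : ∀ {Γ Δ M N} → Γ ⊢ M → Δ ⊆ M ∷ Γ → Δ ⊢ N → Γ ⊢ N
  ⊢-cut m s (ax p) with s p
  ... | here refl = m
  ... | there q   = ax q
  ⊢-cut m s (pubR d) = pubR (⊢-cut m s d)
  ⊢-cut m s (PR d e) = PR (⊢-cut m s d) (⊢-cut m s e)
  ⊢-cut m s (SR d e) = SR (⊢-cut m s d) (⊢-cut m s e)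
  ⊢-cut m s (AR d e) = AR (⊢-cut m s d) (⊢-cut m s e)
  ⊢-cut m s (PL p d) with s p
  ... | here refl = let a , b = ⊢-pair⁻ m in ⊢-cut₂ a b (⊢-cut (⊢-weaken₂ m) (⊆-push₂ s) d)
  ... | there q   = PL q (⊢-cut (⊢-weaken₂ m) (⊆-push₂ s) d)
  ⊢-cut m s (SL p k d) with ⊢-cut m s k | s p
  ... | k' | here refl = ⊢-cut₂ (⊢-senc⁻ m k') k' (⊢-cut (⊢-weaken₂ m) (⊆-push₂ s) d)
  ... | k' | there q   = SL q k' (⊢-cut (⊢-weaken₂ m) (⊆-push₂ s) d)
  ⊢-cut m s (AL p k d) with ⊢-cut m s k | s p
  ... | k' | here refl = ⊢-cut₂ (⊢-aenc⁻ m k') k' (⊢-cut (⊢-weaken₂ m) (⊆-push₂ s) d)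
  ... | k' | there q   = AL q k' (⊢-cut (⊢-weaken₂ m) (⊆-push₂ s) d)

  ⊢-cut₂ : ∀ {Γ A B N} → Γ ⊢ A → Γ ⊢ B → A ∷ B ∷ Γ ⊢ N → Γ ⊢ N
  ⊢-cut₂ a b d = ⊢-cut b ⊆-refl (⊢-cut (⊢-weaken a) ⊆-refl d)

⊢-rename : ∀ θ {Γ M} → Γ ⊢ M → renameSet θ Γ ⊢ rename θ M
⊢-rename θ (ax p)     = ax (∈-map⁺ (rename θ) p)
⊢-rename θ (pubR d)   = pubR (⊢-rename θ d)
⊢-rename θ (PL p d)   = PL (∈-map⁺ (rename θ) p) (⊢-rename θ d)
⊢-rename θ (PR d e)   = PR (⊢-rename θ d) (⊢-rename θ e)
⊢-rename θ (SL p k d) = SL (∈-map⁺ (rename θ) p) (⊢-rename θ k) (⊢-rename θ d)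
⊢-rename θ (SR d e)   = SR (⊢-rename θ d) (⊢-rename θ e)
⊢-rename θ (AL p k d) = AL (∈-map⁺ (rename θ) p) (⊢-rename θ k) (⊢-rename θ d)
⊢-rename θ (AR d e)   = AR (⊢-rename θ d) (⊢-rename θ e)

inverseOn : (Name → Name) → List Name → Name → Name
inverseOn θ []      b = b
inverseOn θ (x ∷ X) b with θ x ℕ.≟ b
... | yes _ = x
... | no  _ = inverseOn θ X b

inverseOn-inverseˡ : ∀ θ X → InjectiveOn θ X → ∀ {a} → a ∈ X → inverseOn θ X (θ a) ≡ a
inverseOn-inverseˡ θ (x ∷ X) inj {a} p with θ x ℕ.≟ θ a | p
... | yes θx≡θa | _       = inj (here refl) p θx≡θa
... | no  θx≢θa | here refl = ⊥-elim (θx≢θa refl)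
... | no  _     | there q = inverseOn-inverseˡ θ X (λ a∈X b∈X → inj (there a∈X) (there b∈X)) q

rename-inverseˡ : ∀ {θ ψ} M → (∀ {a} → a ∈ names M → ψ (θ a) ≡ a) → rename ψ (rename θ M) ≡ M
rename-inverseˡ (nm a)     inv = cong nm (inv (here refl))
rename-inverseˡ (pub K)    inv = cong pub (rename-inverseˡ K inv)
rename-inverseˡ (pair M N) inv =
  cong₂ pair (rename-inverseˡ M (inv ∘ ∈-++⁺ˡ)) (rename-inverseˡ N (inv ∘ ∈-++⁺ʳ (names M)))
rename-inverseˡ (senc M N) inv =
  cong₂ senc (rename-inverseˡ M (inv ∘ ∈-++⁺ˡ)) (rename-inverseˡ N (inv ∘ ∈-++⁺ʳ (names M)))
rename-inverseˡ (aenc M N) inv =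
  cong₂ aenc (rename-inverseˡ M (inv ∘ ∈-++⁺ˡ)) (rename-inverseˡ N (inv ∘ ∈-++⁺ʳ (names M)))

renameSet-inverseˡ : ∀ {θ ψ} Γ → (∀ {a} → a ∈ namesSet Γ → ψ (θ a) ≡ a) →
                     renameSet ψ (renameSet θ Γ) ≡ Γ
renameSet-inverseˡ []      inv = refl
renameSet-inverseˡ (M ∷ Γ) inv =
  cong₂ _∷_ (rename-inverseˡ M (inv ∘ ∈-++⁺ˡ)) (renameSet-inverseˡ Γ (inv ∘ ∈-++⁺ʳ (names M)))

⊢-rename⁻ : ∀ θ {Γ M} → InjectiveOn θ (namesSet Γ ++ names M) → renameSet θ Γ ⊢ rename θ M → Γ ⊢ M
⊢-rename⁻ θ {Γ} {M} inj d =
  subst₂ _⊢_ (renameSet-inverseˡ Γ (ψθ ∘ ∈-++⁺ˡ)) (rename-inverseˡ M (ψθ ∘ ∈-++⁺ʳ (namesSet Γ)))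
         (⊢-rename (inverseOn θ (namesSet Γ ++ names M)) d)
  where
  ψθ = inverseOn-inverseˡ θ (namesSet Γ ++ names M) inj

names⊆namesSet : ∀ {X Γ} → X ∈ Γ → names X ⊆ namesSet Γ
names⊆namesSet (here refl)           = ∈-++⁺ˡ
names⊆namesSet {Γ = Y ∷ _} (there p) = ∈-++⁺ʳ (names Y) ∘ names⊆namesSet p

namesSet-∷∷⊆ : ∀ A B {X Γ} → X ∈ Γ → names A ++ names B ⊆ names X → namesSet (A ∷ B ∷ Γ) ⊆ namesSet Γ
namesSet-∷∷⊆ A B X∈Γ AB⊆X a∈ with ∈-++⁻ (names A) a∈
... | inj₁ a∈A = names⊆namesSet X∈Γ (AB⊆X (∈-++⁺ˡ a∈A))
... | inj₂ a∈BΓ with ∈-++⁻ (names B) a∈BΓ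
...   | inj₁ a∈B = names⊆namesSet X∈Γ (AB⊆X (∈-++⁺ʳ (names A) a∈B))
...   | inj₂ a∈Γ = a∈Γ

⊢-strengthen : ∀ {Δ Γ M a} → Δ ⊆ nm a ∷ Γ → a ∉ namesSet Γ → a ∉ names M → Δ ⊢ M → Γ ⊢ M
⊢-strengthen s a∉Γ a∉M (ax p) with s p
... | here refl = ⊥-elim (a∉M (here refl))
... | there q   = ax q
⊢-strengthen s a∉Γ a∉M (pubR d) = pubR (⊢-strengthen s a∉Γ a∉M d)
⊢-strengthen s a∉Γ a∉M (PR {M = A} d e) =
  PR (⊢-strengthen s a∉Γ (a∉M ∘ ∈-++⁺ˡ) d) (⊢-strengthen s a∉Γ (a∉M ∘ ∈-++⁺ʳ (names A)) e)
⊢-strengthen s a∉Γ a∉M (SR {M = A} d e) =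
  SR (⊢-strengthen s a∉Γ (a∉M ∘ ∈-++⁺ˡ) d) (⊢-strengthen s a∉Γ (a∉M ∘ ∈-++⁺ʳ (names A)) e)
⊢-strengthen s a∉Γ a∉M (AR {M = A} d e) =
  AR (⊢-strengthen s a∉Γ (a∉M ∘ ∈-++⁺ˡ) d) (⊢-strengthen s a∉Γ (a∉M ∘ ∈-++⁺ʳ (names A)) e)
⊢-strengthen s a∉Γ a∉M (PL {M = A} {N = B} p d) with s p
... | there q = PL q (⊢-strengthen (⊆-push₂ s) (a∉Γ ∘ namesSet-∷∷⊆ A B q id) a∉M d)
⊢-strengthen s a∉Γ a∉M (SL {M = A} {K = K} p k d) with s p
... | there q = SL q (⊢-strengthen s a∉Γ (a∉Γ ∘ names⊆namesSet q ∘ ∈-++⁺ʳ (names A)) k)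
                     (⊢-strengthen (⊆-push₂ s) (a∉Γ ∘ namesSet-∷∷⊆ A K q id) a∉M d)
⊢-strengthen s a∉Γ a∉M (AL {M = A} {K = K} p k d) with s p
... | there q = AL q (⊢-strengthen s a∉Γ (a∉Γ ∘ names⊆namesSet q ∘ ∈-++⁺ʳ (names A)) k)
                     (⊢-strengthen (⊆-push₂ s) (a∉Γ ∘ namesSet-∷∷⊆ A K q id) a∉M d)

infix 4 _≟_
_≟_ : DecidableEquality Msg
nm a ≟ nm b = map′ (cong nm) (λ { refl → refl }) (a ℕ.≟ b)
pub K ≟ pub L = map′ (cong pub) (λ { refl → refl }) (K ≟ L)
pair A B ≟ pair C D = map′ (λ { (refl , refl) → refl }) (λ { refl → refl , refl }) (A ≟ C ×-dec B ≟ D)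
senc A B ≟ senc C D = map′ (λ { (refl , refl) → refl }) (λ { refl → refl , refl }) (A ≟ C ×-dec B ≟ D)
aenc A B ≟ aenc C D = map′ (λ { (refl , refl) → refl }) (λ { refl → refl , refl }) (A ≟ C ×-dec B ≟ D)
nm _     ≟ pair _ _ = no λ ()
nm _     ≟ senc _ _ = no λ ()
nm _     ≟ aenc _ _ = no λ ()
nm _     ≟ pub _    = no λ ()
pair _ _ ≟ nm _     = no λ ()
pair _ _ ≟ senc _ _ = no λ ()
pair _ _ ≟ aenc _ _ = no λ ()
pair _ _ ≟ pub _    = no λ ()
senc _ _ ≟ nm _     = no λ ()
senc _ _ ≟ pair _ _ = no λ ()
senc _ _ ≟ aenc _ _ = no λ ()
senc _ _ ≟ pub _    = no λ ()
aenc _ _ ≟ nm _     = no λ ()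
aenc _ _ ≟ pair _ _ = no λ ()
aenc _ _ ≟ senc _ _ = no λ ()
aenc _ _ ≟ pub _    = no λ ()
pub _    ≟ nm _     = no λ ()
pub _    ≟ pair _ _ = no λ ()
pub _    ≟ senc _ _ = no λ ()
pub _    ≟ aenc _ _ = no λ ()

open Data.List.Membership.DecPropositional _≟_ using (_∈?_)

data Synth (W : MsgSet) : Msg → Set where
  member : ∀ {M}   → M ∈ W → Synth W M
  pub    : ∀ {K}   → Synth W K → Synth W (pub K)
  pair   : ∀ {A B} → Synth W A → Synth W B → Synth W (pair A B)
  senc   : ∀ {A B} → Synth W A → Synth W B → Synth W (senc A B)
  aenc   : ∀ {A B} → Synth W A → Synth W B → Synth W (aenc A B)

Synth⇒⊢ : ∀ {W M} → Synth W M → W ⊢ M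
Synth⇒⊢ (member p) = ax p
Synth⇒⊢ (pub k)    = pubR (Synth⇒⊢ k)
Synth⇒⊢ (pair a b) = PR (Synth⇒⊢ a) (Synth⇒⊢ b)
Synth⇒⊢ (senc a b) = SR (Synth⇒⊢ a) (Synth⇒⊢ b)
Synth⇒⊢ (aenc a b) = AR (Synth⇒⊢ a) (Synth⇒⊢ b)

synth? : ∀ W M → Dec (Synth W M)
synth? W M with M ∈? W
... | yes M∈W = yes (member M∈W)
synth? W (nm a)     | no M∉W = no λ { (member M∈W) → M∉W M∈W }
synth? W (pub K)    | no M∉W =
  map′ pub (λ { (member M∈W) → ⊥-elim (M∉W M∈W) ; (pub k) → k }) (synth? W K)
synth? W (pair A B) | no M∉W =
  map′ (uncurry pair) (λ { (member M∈W) → ⊥-elim (M∉W M∈W) ; (pair a b) → a , b }) (synth? W A ×-dec synth? W B)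
synth? W (senc A B) | no M∉W =
  map′ (uncurry senc) (λ { (member M∈W) → ⊥-elim (M∉W M∈W) ; (senc a b) → a , b }) (synth? W A ×-dec synth? W B)
synth? W (aenc A B) | no M∉W =
  map′ (uncurry aenc) (λ { (member M∈W) → ⊥-elim (M∉W M∈W) ; (aenc a b) → a , b }) (synth? W A ×-dec synth? W B)

data Analysable (W : MsgSet) : Msg → Set where
  pair : ∀ {A B} → Analysable W (pair A B)
  senc : ∀ {A K} → Synth W K → Analysable W (senc A K)
  aenc : ∀ {A K} → Synth W K → Analysable W (aenc A (pub K))

analysable? : ∀ W M → Dec (Analysable W M)
analysable? W (nm _)            = no λ ()
analysable? W (pub _)           = no λ ()
analysable? W (pair _ _)        = yes pair
analysable? W (senc _ K)        = map′ senc (λ { (senc k) → k }) (synth? W K)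
analysable? W (aenc _ (pub K))  = map′ aenc (λ { (aenc k) → k }) (synth? W K)
analysable? W (aenc _ (nm _))     = no λ ()
analysable? W (aenc _ (pair _ _)) = no λ ()
analysable? W (aenc _ (senc _ _)) = no λ ()
analysable? W (aenc _ (aenc _ _)) = no λ ()

Analysed : MsgSet → Set
Analysed W = ¬ Any (Analysable W) W

-- Over an analysed W, every left rule acts on a member of W that was already
-- built by right rules, so its conclusion is reachable by right rules too.
⊢⇒Synth : ∀ {W Δ M} → Analysed W → All (Synth W) Δ → Δ ⊢ M → Synth W M
⊢⇒Synth an h (ax p)     = lookup h p
⊢⇒Synth an h (pubR d)   = pub (⊢⇒Synth an h d)
⊢⇒Synth an h (PR d e)   = pair (⊢⇒Synth an h d) (⊢⇒Synth an h e)
⊢⇒Synth an h (SR d e)   = senc (⊢⇒Synth an h d) (⊢⇒Synth an h e)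
⊢⇒Synth an h (AR d e)   = aenc (⊢⇒Synth an h d) (⊢⇒Synth an h e)
⊢⇒Synth an h (PL p d) with lookup h p
... | member q = ⊥-elim (an (lose q pair))
... | pair a b = ⊢⇒Synth an (a ∷ b ∷ h) d
⊢⇒Synth an h (SL p k d) with ⊢⇒Synth an h k | lookup h p
... | k' | member q = ⊥-elim (an (lose q (senc k')))
... | k' | senc a _ = ⊢⇒Synth an (a ∷ k' ∷ h) d
⊢⇒Synth an h (AL p k d) with ⊢⇒Synth an h k | lookup h p
... | k' | member q = ⊥-elim (an (lose q (aenc k')))
... | k' | aenc a _ = ⊢⇒Synth an (a ∷ k' ∷ h) d

size : Msg → ℕ
size (nm _)     = 1
size (pub K)    = suc (size K)
size (pair A B) = suc (size A + size B)
size (senc A B) = suc (size A + size B)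
size (aenc A B) = suc (size A + size B)

weight : MsgSet → ℕ
weight W = sum (map size W)

weight-↭ : ∀ {W V} → W ↭ V → weight W ≡ weight V
weight-↭ = sum-↭ ∘ map⁺ size

∈⇒↭ : ∀ {x : Msg} {W} → x ∈ W → ∃ λ R → W ↭ x ∷ R
∈⇒↭ x∈W with ys , zs , refl ← ∈-∃++ x∈W = ys ++ zs , shift _ ys zs

data Decomposition (W : MsgSet) (x : Msg) : Set where
  decomposition : ∀ {A B} → W ⊢ A → W ⊢ B → A ∷ B ∷ [] ⊢ x → size A + size B < size x →
                  Decomposition W x

decompose : ∀ {W x} → x ∈ W → Analysable W x → Decomposition W x
decompose x∈W pair =
  let a , b = ⊢-pair⁻ (ax x∈W) in
  decomposition a b (PR (ax (here refl)) (ax (there (here refl)))) (n<1+n _)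
decompose x∈W (senc k) =
  decomposition (⊢-senc⁻ (ax x∈W) (Synth⇒⊢ k)) (Synth⇒⊢ k) (SR (ax (here refl)) (ax (there (here refl)))) (n<1+n _)
decompose x∈W (aenc {A} k) =
  decomposition (⊢-aenc⁻ (ax x∈W) (Synth⇒⊢ k)) (Synth⇒⊢ k) (AR (ax (here refl)) (pubR (ax (there (here refl)))))
                (s≤s (+-monoʳ-≤ (size A) (n≤1+n _)))

_≋_ : MsgSet → MsgSet → Set
Γ ≋ Δ = (∀ {M} → Γ ⊢ M → Δ ⊢ M) × (∀ {M} → Δ ⊢ M → Γ ⊢ M)

replace-decomposed : ∀ {W x R} → W ↭ x ∷ R → Decomposition W x →
                     Σ MsgSet λ V → weight V < weight W × W ≋ V
replace-decomposed {W} {x} {R} W↭xR (decomposition {A} {B} a b ab⊢x smaller) =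
  A ∷ B ∷ R , lighter , (⊢-cut (⊢-mono (xs⊆xs++ys (A ∷ B ∷ []) R) ab⊢x) W⊆xV , ⊢-cut₂ a b ∘ ⊢-mono AB⊆ABW)
  where
  W⊆xV : W ⊆ x ∷ A ∷ B ∷ R
  W⊆xV = ⊆-trans (⊆-reflexive-↭ W↭xR) (∷⁺ʳ x (xs⊆ys++xs R (A ∷ B ∷ [])))
  AB⊆ABW : A ∷ B ∷ R ⊆ A ∷ B ∷ W
  AB⊆ABW = ∷⁺ʳ A (∷⁺ʳ B (⊆-trans (xs⊆x∷xs R x) (⊆-reflexive-↭ (↭-sym W↭xR))))
  lighter : weight (A ∷ B ∷ R) < weight W
  lighter = begin-strict
    size A + (size B + weight R) ≡⟨ +-assoc (size A) (size B) (weight R) ⟨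
    size A + size B + weight R   <⟨ +-monoˡ-< (weight R) smaller ⟩
    size x + weight R            ≡⟨ weight-↭ W↭xR ⟨
    weight W                     ∎
    where open ≤-Reasoning

saturate : ∀ W → Acc _<_ (weight W) → Σ MsgSet λ V → Analysed V × W ≋ V
saturate W (acc rec) with any? (analysable? W) W
... | no analysed = W , analysed , (id , id)
... | yes some
  with x , x∈W , x-analysable ← find some
  with R , W↭xR ← ∈⇒↭ x∈W
  with V , V<W , (W⇒V , V⇒W) ← replace-decomposed W↭xR (decompose x∈W x-analysable)
  with U , analysed , (V⇒U , U⇒V) ← saturate V (rec V<W)
  = U , analysed , (V⇒U ∘ W⇒V , V⇒W ∘ U⇒V)

⊢-dec : ∀ Γ M → Dec (Γ ⊢ M)
⊢-dec Γ M with V , analysed , (Γ⇒V , V⇒Γ) ← saturate Γ (<-wellFounded _) =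
  map′ (V⇒Γ ∘ Synth⇒⊢) (⊢⇒Synth analysed (tabulate member) ∘ Γ⇒V) (synth? V M)

proposition4 : IsEffectiveIntruderModel _⊢_
proposition4 = record
  { Id         = λ M → ax (here refl)
  ; Mon        = ⊢-mono
  ; Cut        = λ m d → ⊢-cut m ⊆-refl d
  ; ConstrPair = λ M N → PR (ax (here refl)) (ax (there (here refl)))
  ; ConstrSenc = λ M N → SR (ax (here refl)) (ax (there (here refl)))
  ; ConstrAenc = λ M N → AR (ax (here refl)) (ax (there (here refl)))
  ; ConstrPub  = λ K → pubR (ax (here refl))
  ; Alpha      = λ Γ M θ inj → ⊢-rename⁻ θ inj , ⊢-rename θ
  ; Relevancy  = λ Γ M a d a∉Γ a∉M → ⊢-strengthen ⊆-refl a∉Γ a∉M d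
  ; Decidable  = ⊢-dec
  }
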